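{- Let $M$ be a finite monoid. Then $M$ is Ramsey if and only if $M$ is $\mathbb Y$-controllable and $\mathbb X(M)$ is linear.
   Context: $\mathbb X(M)=\{aM:a\in M\}$, linear if linearly ordered by inclusion. $\mathbb Y(M)$ is the set of nonempty subsets of $\mathbb X(M)$ linearly ordered by inclusion; $x\le_{\mathbb Y(M)}y$ iff $x\subseteq y$ and every element of $y\setminus x$ is larger under $\subseteq$ than every element of $x$. $M$ acts on $\mathbb Y(M)$ by $mx=\{maM:aM\in x\}$. $\langle\mathbb Y(M)\rangle$ (operation $\vee$) is the semigroup freely generated by $\mathbb Y(M)$ modulo $p\vee q=q=q\vee p$ for $p\le_{\mathbb Y(M)}q$. An $M$-set is a set with a left $M$-action; a pointed $M$-set is an $M$-set $X$ with a distinguished point $x$ such that $Mx=X$. The action on a family $(X_n)_{n\in\omega}$ is uniform if the actions agree on overlaps. $\langle(X_n)_{n\in\omega}\rangle$ is the partial semigroup under concatenation $^\frown$ of words $x_1{}^\frown\cdots{}^\frown x_k$ with $x_j\in X_{i_j}$ for some $i_1<\dots<i_k$, with coordinate-wise $M$-action. A sequence $\bar s$ in it is basic if $s_{i_0}{}^\frown\cdots{}^\frown s_{i_n}$ lies in it for all $i_0<\dots<i_n$; $s_n$ has a distinguished point if some letter $x_j\in X_{i_j}$ of it is the distinguished point of $X_{i_j}$. The $M$-span is $\langle\bar s\rangle_M=\{m_0s_{i_0}\cdots m_ns_{i_n}: i_0<\dots<i_n,\ m_i\in M,\ \text{some } m_i=1_M\}$. $M$ is Ramsey if for every sequence of pointed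 $M$-sets $(X_n)$ acted on uniformly and every finite coloring of $\langle(X_n)\rangle$ there is a basic $\bar s$, each $s_n$ having a distinguished point, with $\langle\bar s\rangle_M$ monochromatic. $M$ is $\mathbb Y$-controllable if for every finite $F\subseteq\langle\mathbb Y(M)\rangle$, every maximal $\mathbf y\in\mathbb Y(M)$, every such $(X_n)$ and every finite coloring of $\langle(X_n)\rangle$ there is a basic $\bar s$, each $s_n$ having a distinguished point, such that for all $m,n$ and $a_i,b_j\in M$: if $a_0\mathbf y\vee\dots\vee a_n\mathbf y\in F$ and $a_0\mathbf y\vee\dots\vee a_n\mathbf y=b_0\mathbf y\vee\dots\vee b_m\mathbf y$ then $a_0s_{i_0}\cdots a_ns_{i_n}$ and $b_0s_{j_0}\cdots b_ms_{j_m}$ have the same color for all $i_0<\dots<i_n$, $j_0<\dots<j_m$. -}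

module Defs where

open import Level using (Level; 0ℓ) renaming (suc to lsuc)
open import Data.Nat using (ℕ; zero; suc; _≤_; _<_)
open import Data.Fin using (Fin)
open import Data.Product using (Σ; ∃; ∃-syntax; _×_; _,_; proj₁; proj₂)
open import Data.Sum using (_⊎_; inj₁; inj₂)
open import Data.List using (List; []; _∷_; _++_; map; concatMap)
open import Data.List.Relation.Unary.Any using (Any)
open import Data.List.Relation.Unary.Linked using (Linked)
open import Relation.Nullary using (¬_)
open import Relation.Binary.PropositionalEquality
  using (_≡_; _≢_; refl; sym; trans; cong)
open import Algebra.Structures using (IsMonoid)
open import Function.Bundles using (_↔_)

record FinMonoid : Set₁ where
  field
    Carrier  : Set
    _∙_      : Carrier → Carrier → Carrier
    ε        : Carrier
    isMonoid : IsMonoid _≡_ _∙_ ε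
    finite   : Σ ℕ λ n → Carrier ↔ Fin n
  infixl 7 _∙_

module _ (M : FinMonoid) where
  open FinMonoid M
  open IsMonoid isMonoid using (assoc; identityʳ)

  _∈R_ : Carrier → Carrier → Set
  x ∈R a = ∃[ c ] x ≡ a ∙ c

  IdealSub : Carrier → Carrier → Set
  IdealSub a b = ∀ x → x ∈R a → x ∈R b

  SameIdeal : Carrier → Carrier → Set
  SameIdeal a b = IdealSub a b × IdealSub b a

  XLinear : Set
  XLinear = ∀ a b → IdealSub a b ⊎ IdealSub b a

  -- 𝕐(M): nonempty subsets of 𝕏(M) linearly ordered by inclusion.
  -- A subset x of 𝕏(M) is given by the predicate  mem a  ⇔  aM ∈ x,
  -- which is required to depend only on the ideal aM.

  record YElem : Set₁ where
    field
      mem   : Carrier → Set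
      inv   : ∀ a b → SameIdeal a b → mem a → mem b
      ne    : ∃[ a ] mem a
      chain : ∀ a b → mem a → mem b → IdealSub a b ⊎ IdealSub b a
  open YElem public

  _≃Y_ : YElem → YElem → Set
  x ≃Y y = ∀ a → (mem x a → mem y a) × (mem y a → mem x a)

  _≤Y_ : YElem → YElem → Set
  x ≤Y y = (∀ a → mem x a → mem y a)
         × (∀ a b → mem x a → mem y b → ¬ mem x b → IdealSub a b)

  MaximalY : YElem → Set₁
  MaximalY y = ∀ z → y ≤Y z → z ≃Y y

  private
    sub-refl : ∀ a → IdealSub a a
    sub-refl a x p = p

    sub-trans : ∀ {a b c} → IdealSub a b → IdealSub b c → IdealSub a c
    sub-trans p q x r = q x (p x r)

    self∈ : ∀ a → a ∈R a
    self∈ a = ε , sym (identityʳ a)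

    sub-mul : ∀ m a b → IdealSub a b → IdealSub (m ∙ a) (m ∙ b)
    sub-mul m a b p x (d , x≡) with p a (self∈ a)
    ... | (c , a≡) = c ∙ d , trans x≡ (trans (cong (λ t → (m ∙ t) ∙ d) a≡)
                       (trans (assoc m (b ∙ c) d)
                       (trans (cong (m ∙_) (assoc b c d)) (sym (assoc m b (c ∙ d))))))

  actY : Carrier → YElem → YElem
  mem   (actY m x) b = ∃[ a ] (mem x a × SameIdeal b (m ∙ a))
  inv   (actY m x) b b' (p , q) (a , xa , (r , s)) =
    a , xa , (sub-trans q r , sub-trans s p)
  ne    (actY m x) with ne x
  ... | (a , xa) = m ∙ a , a , xa , (sub-refl _ , sub-refl _)
  chain (actY m x) b b' (a , xa , (r , s)) (a' , xa' , (r' , s'))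
    with chain x a a' xa xa'
  ... | inj₁ p = inj₁ (sub-trans r (sub-trans (sub-mul m a a' p) s'))
  ... | inj₂ p = inj₂ (sub-trans r' (sub-trans (sub-mul m a' a p) s))

  -- ⟨𝕐(M)⟩: nonempty words over 𝕐(M) modulo the congruence generated by
  -- p ∨ q = q = q ∨ p for p ≤_𝕐 q (and equality of elements of 𝕐(M)).

  data _~_ : List YElem → List YElem → Set₁ where
    absorbˡ : ∀ u v p q → p ≤Y q → (u ++ p ∷ q ∷ v) ~ (u ++ q ∷ v)
    absorbʳ : ∀ u v p q → p ≤Y q → (u ++ q ∷ p ∷ v) ~ (u ++ q ∷ v)
    ext     : ∀ u v p q → p ≃Y q → (u ++ p ∷ v) ~ (u ++ q ∷ v)
    ~refl   : ∀ w → w ~ w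
    ~sym    : ∀ {w w'} → w ~ w' → w' ~ w
    ~trans  : ∀ {w w' w''} → w ~ w' → w' ~ w'' → w ~ w''

  -- membership of an element of ⟨𝕐(M)⟩ in a finite subset F of ⟨𝕐(M)⟩
  -- given by a list of representatives
  _∈Y_ : List YElem → List (List YElem) → Set₁
  w ∈Y F = Any (λ v → v ~ w) F

  -- Sequences (X_n) of pointed M-sets acted on uniformly.
  -- All X_n live in a common ambient type U and a single map `act` gives
  -- the action (so the actions agree on overlaps).

  record MSystem : Set₁ where
    field
      U      : Set
      X      : ℕ → U → Set
      act    : Carrier → U → U
      closed : ∀ n m u → X n u → X n (act m u)
      act-ε  : ∀ n u → X n u → act ε u ≡ u
      act-∙  : ∀ n m m' u → X n u → act (m ∙ m') u ≡ act m (act m' u)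
      pt     : ℕ → U
      pt∈    : ∀ n → X n (pt n)
      gen    : ∀ n u → X n u → ∃[ m ] act m (pt n) ≡ u

  module _ (S : MSystem) where
    open MSystem S

    -- WordFrom k w : w = x₁⁀⋯⁀x_j with x_l ∈ X_{i_l}, k ≤ i₁ < ⋯ < i_j
    data WordFrom : ℕ → List U → Set where
      []  : ∀ {k} → WordFrom k []
      _∷_ : ∀ {k i u w} → (k ≤ i × X i u) → WordFrom (suc i) w → WordFrom k (u ∷ w)

    IsWord : List U → Set
    IsWord w = WordFrom 0 w × w ≢ []

    -- w ∈ ⟨(X_n)⟩ via some index assignment in which some letter x_l is
    -- the distinguished point of X_{i_l}
    data WordDP : ℕ → List U → Set where
      here  : ∀ {k i u w} → k ≤ i → u ≡ pt i → WordFrom (suc i) w → WordDP k (u ∷ w)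
      there : ∀ {k i u w} → k ≤ i → X i u → WordDP (suc i) w → WordDP k (u ∷ w)

    HasDP : List U → Set
    HasDP w = WordDP 0 w

    Basic : (ℕ → List U) → Set
    Basic s = ∀ (is : List ℕ) → is ≢ [] → Linked _<_ is → IsWord (concatMap s is)

    Selection : List (ℕ × Carrier) → Set
    Selection sel = sel ≢ [] × Linked _<_ (map proj₁ sel)

    applySel : (ℕ → List U) → List (ℕ × Carrier) → List U
    applySel s sel = concatMap (λ p → map (act (proj₂ p)) (s (proj₁ p))) sel

  yWord : YElem → List (ℕ × Carrier) → List YElem
  yWord y sel = map (λ p → actY (proj₂ p) y) sel

  Ramsey : Set₁
  Ramsey =
    ∀ (S : MSystem) (k : ℕ) (c : List (MSystem.U S) → Fin k) →
    ∃[ s ] (Basic S s × (∀ n → HasDP S (s n)) ×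
      ∃[ col ] (∀ sel → Selection S sel →
                 Any (λ p → proj₂ p ≡ ε) sel →
                 c (applySel S s sel) ≡ col))

  YControllable : Set₁
  YControllable =
    ∀ (F : List (List YElem)) (y : YElem) → MaximalY y →
    ∀ (S : MSystem) (k : ℕ) (c : List (MSystem.U S) → Fin k) →
    ∃[ s ] (Basic S s × (∀ n → HasDP S (s n)) ×
      (∀ as bs → Selection S as → Selection S bs →
        yWord y as ∈Y F → yWord y as ~ yWord y bs →
        c (applySel S s as) ≡ c (applySel S s bs)))

-- If aM and bM were incomparable, colour a word by whether its last letter x
-- with a ∈ xM or b ∈ xM has a ∈ xM.  For a Ramsey sequence the words
-- s₀ ⁀ a s₁ and s₀ ⁀ b s₁ get different colours: s₁ contains 1, and no letter
-- of a s₁ (of b s₁) has b (has a) in its ideal.  So Ramsey monoids have 𝕏(M)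
-- linear.  When 𝕏(M) is linear, every selection m₀ s_{i₀} ⋯ m_n s_{i_n} is the
-- translate, by its coefficient a of largest ideal, of a selection with some
-- coefficient 1.  Applying the Ramsey property to the tuple of colours of all
-- |M| translates makes the colour of a word depend only on aM, and aM is
-- recovered from a₀𝐲 ∨ ⋯ ∨ a_n𝐲 as the largest ideal occurring in it (a maximal
-- 𝐲 contains M).  Conversely, for 𝐲 = 𝕏(M) every word a₀𝐲 ∨ ⋯ ∨ a_n𝐲 with some
-- aᵢ = 1 collapses to 𝐲, so 𝕐-controllability for F = {𝐲} is the Ramsey property.
module Submission where

open import Defs
open import Data.Product using (_×_)
open import Function.Bundles using (_⇔_)

open import Data.Nat using (ℕ; _<_; _^_; z<s)
open import Data.Fin using (Fin; zero; suc; funToFin; finToFun)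
open import Data.Fin.Properties using (any?; finToFun-funToFin; 0≢1+n)
  renaming (_≟_ to _≟ᶠ_)
open import Data.Product using (∃; ∃-syntax; _,_; proj₁; proj₂; map₂)
open import Data.Sum using (_⊎_; inj₁; inj₂)
open import Data.Empty using (⊥-elim)
open import Data.Unit using (⊤; tt)
open import Data.Maybe using (Maybe; just; nothing; fromMaybe; _<∣>_)
open import Data.List using (List; []; _∷_; _++_; map; [_])
open import Data.List.Properties using (map-++; map-∘; map-cong-local)
open import Data.List.Relation.Unary.All as All using (All; []; _∷_)
import Data.List.Relation.Unary.All.Properties as All
open import Data.List.Relation.Unary.Any as Any using (Any; here; there)
import Data.List.Relation.Unary.Any.Properties as Any
open import Data.List.Relation.Unary.Linked using (Linked; [-]; _∷_)
open import Relation.Nullary using (¬_; Dec; yes; no)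
import Relation.Nullary.Decidable as Dec
open import Relation.Binary.Definitions using (DecidableEquality)
open import Relation.Binary.PropositionalEquality
  using (_≡_; _≢_; refl; sym; trans; cong; cong₂; subst; module ≡-Reasoning)
open import Algebra.Structures using (IsMonoid)
open import Function.Base using (_∘_; _$_)
open import Function.Bundles using (Inverse; mk⇔; module Equivalence)
open import Function.Properties.Inverse using (↔⇒↣)
open import Function.Construct.Identity using (⇔-id)
open import Function.Construct.Symmetry using (⇔-sym)
open import Function.Construct.Composition using (_⇔-∘_)

lastJust : {A B : Set} → (A → Maybe B) → List A → Maybe B
lastJust f []       = nothing
lastJust f (x ∷ xs) = lastJust f xs <∣> f x

NothingOrJust : {B : Set} → B → Maybe B → Set
NothingOrJust r m = m ≡ nothing ⊎ m ≡ just r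

module _ {A B : Set} (f : A → Maybe B) where

  lastJust-++ : ∀ xs {ys} {r} → lastJust f ys ≡ just r → lastJust f (xs ++ ys) ≡ just r
  lastJust-++ []       e = e
  lastJust-++ (x ∷ xs) e = cong (_<∣> f x) (lastJust-++ xs e)

  lastJust-nothingOrJust : ∀ {r xs} → All (NothingOrJust r ∘ f) xs →
                           NothingOrJust r (lastJust f xs)
  lastJust-nothingOrJust []                  = inj₁ refl
  lastJust-nothingOrJust (fx ∷ h) with lastJust-nothingOrJust h
  ... | inj₁ e rewrite e = fx
  ... | inj₂ e rewrite e = inj₂ refl

  lastJust-unique : ∀ {r xs} → All (NothingOrJust r ∘ f) xs → Any (λ x → f x ≡ just r) xs →
                    lastJust f xs ≡ just r
  lastJust-unique {xs = x ∷ _} (_ ∷ h) (there p) = cong (_<∣> f x) (lastJust-unique h p)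
  lastJust-unique (_ ∷ h) (here fx) rewrite fx
    with lastJust-nothingOrJust h
  ... | inj₁ e rewrite e = refl
  ... | inj₂ e rewrite e = refl

All-splice : ∀ {a p} {A : Set a} {P : A → Set p} u w w′ v →
             All P w ⇔ All P w′ → All P (u ++ w ++ v) ⇔ All P (u ++ w′ ++ v)
All-splice {P = P} u _ _ v w⇔w′ =
  mk⇔ (replace (Equivalence.to w⇔w′)) (replace (Equivalence.from w⇔w′))
  where
  replace : ∀ {w w′} → (All P w → All P w′) → All P (u ++ w ++ v) → All P (u ++ w′ ++ v)
  replace f h with All.++⁻ u h
  ... | hu , hwv = All.++⁺ hu (All.++⁺ (f (All.++⁻ˡ _ hwv)) (All.++⁻ʳ _ hwv))

module _ (M : FinMonoid) where
  open FinMonoid M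
  open IsMonoid isMonoid using (assoc; identityˡ; identityʳ)

  private
    infix 4 _∈_ _⊆_ _≋_
    _∈_ : Carrier → Carrier → Set
    _∈_ = _∈R_ M
    _⊆_ : Carrier → Carrier → Set
    _⊆_ = IdealSub M
    _≋_ : List (YElem M) → List (YElem M) → Set₁
    _≋_ = _~_ M

  ⊆-refl : ∀ {a} → a ⊆ a
  ⊆-refl _ x∈a = x∈a

  ⊆-trans : ∀ {a b c} → a ⊆ b → b ⊆ c → a ⊆ c
  ⊆-trans a⊆b b⊆c x x∈a = b⊆c x (a⊆b x x∈a)

  ∈-refl : ∀ a → a ∈ a
  ∈-refl a = ε , sym (identityʳ a)

  ∈⇒⊆ : ∀ {x a} → x ∈ a → x ⊆ a
  ∈⇒⊆ {x} {a} (c , refl) z (d , refl) = c ∙ d , assoc a c d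

  ⊆⇒∈ : ∀ {x a} → x ⊆ a → x ∈ a
  ⊆⇒∈ {x} x⊆a = x⊆a x (∈-refl x)

  ∙-⊆ : ∀ a d → a ∙ d ⊆ a
  ∙-⊆ a d = ∈⇒⊆ (d , refl)

  ∈-∙ε : ∀ a → a ∈ a ∙ ε
  ∈-∙ε a = ε , sym (trans (identityʳ _) (identityʳ a))

  ∉-∙ : ∀ {b a} m → ¬ b ∈ a → ¬ b ∈ a ∙ m
  ∉-∙ {a = a} m b∉a b∈am = b∉a (⊆⇒∈ (⊆-trans (∈⇒⊆ b∈am) (∙-⊆ a m)))

  ⊆-ε : ∀ a → a ⊆ ε
  ⊆-ε a = ∈⇒⊆ (a , sym (identityˡ a))

  ≡⇒SameIdeal : ∀ {a b} → a ≡ b → SameIdeal M a b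
  ≡⇒SameIdeal refl = ⊆-refl , ⊆-refl

  open Inverse (proj₂ finite) using (to; from; strictlyInverseʳ)

  _≟_ : DecidableEquality Carrier
  _≟_ = Dec.via-injection (↔⇒↣ (proj₂ finite)) _≟ᶠ_

  _∈?_ : ∀ x a → Dec (x ∈ a)
  x ∈? a = Dec.map (mk⇔ (λ (i , e) → from i , e) fromWitness)
                   (any? (λ i → x ≟ (a ∙ from i)))
    where
    fromWitness : x ∈ a → ∃[ i ] x ≡ a ∙ from i
    fromWitness (c , e) = to c , trans e (cong (a ∙_) (sym (strictlyInverseʳ c)))

  regularSystem : MSystem M
  regularSystem = record
    { U = Carrier ; X = λ _ _ → ⊤ ; act = _∙_ ; closed = λ _ _ _ _ → tt
    ; act-ε = λ _ u _ → identityˡ u ; act-∙ = λ _ m m′ u _ → assoc m m′ u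
    ; pt = λ _ → ε ; pt∈ = λ _ → tt ; gen = λ _ u _ → u , identityʳ u }

  hasDP⇒ε∈ : ∀ {k w} → WordDP M regularSystem k w → Any (_≡ ε) w
  hasDP⇒ε∈ (here _ e _)  = here e
  hasDP⇒ε∈ (there _ _ d) = there (hasDP⇒ε∈ d)

  pairSelection : ∀ S a b → Selection M S ((0 , a) ∷ (1 , b) ∷ [])
  pairSelection _ _ _ = (λ ()) , (z<s ∷ [-])

  module Incomparable (a b : Carrier) (a∉bM : ¬ a ∈ b) (b∉aM : ¬ b ∈ a) where

    classify : Carrier → Maybe (Fin 2)
    classify x with a ∈? x | b ∈? x
    ... | yes _ | _     = just zero
    ... | no _  | yes _ = just (suc zero)
    ... | no _  | no _  = nothing

    classify-above-a : ∀ {x} → a ∈ x → classify x ≡ just zero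
    classify-above-a {x} a∈x with a ∈? x | b ∈? x
    ... | yes _   | _ = refl
    ... | no a∉x  | _ = ⊥-elim (a∉x a∈x)

    classify-not-above-b : ∀ {x} → ¬ b ∈ x → NothingOrJust zero (classify x)
    classify-not-above-b {x} b∉x with a ∈? x | b ∈? x
    ... | yes _ | _       = inj₂ refl
    ... | no _  | yes b∈x = ⊥-elim (b∉x b∈x)
    ... | no _  | no _    = inj₁ refl

    classify-above-b : ∀ {x} → ¬ a ∈ x → b ∈ x → classify x ≡ just (suc zero)
    classify-above-b {x} a∉x b∈x with a ∈? x | b ∈? x
    ... | yes a∈x | _      = ⊥-elim (a∉x a∈x)
    ... | no _    | yes _  = refl
    ... | no _    | no b∉x = ⊥-elim (b∉x b∈x)

    classify-not-above-a : ∀ {x} → ¬ a ∈ x → NothingOrJust (suc zero) (classify x)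
    classify-not-above-a {x} a∉x with a ∈? x | b ∈? x
    ... | yes a∈x | _     = ⊥-elim (a∉x a∈x)
    ... | no _    | yes _ = inj₂ refl
    ... | no _    | no _  = inj₁ refl

    colour : List Carrier → Fin 2
    colour = fromMaybe zero ∘ lastJust classify

    colour-pair : ∀ {r} g → (∀ m → NothingOrJust r (classify (g ∙ m))) →
                  classify (g ∙ ε) ≡ just r → ∀ s → Any (_≡ ε) (s 1) →
                  colour (applySel M regularSystem s ((0 , ε) ∷ (1 , g) ∷ [])) ≡ r
    colour-pair g classify-g∙ classify-g s ε∈s₁ =
      cong (fromMaybe zero)
        (lastJust-++ classify (map (ε ∙_) (s 0))
          (lastJust-unique classify
            (All.++⁺ (All.map⁺ (All.universal classify-g∙ (s 1))) [])
            (Any.++⁺ˡ (Any.map⁺ (Any.map (λ { refl → classify-g }) ε∈s₁)))))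

    not-ramsey : ¬ Ramsey M
    not-ramsey R with R regularSystem 2 colour
    ... | s , _ , dp , col , mono = 0≢1+n (begin
      zero                                          ≡⟨ colour-a ⟨
      colour (applySel M regularSystem s (pair a))  ≡⟨ mono-pair a ⟩
      col                                           ≡⟨ mono-pair b ⟨
      colour (applySel M regularSystem s (pair b))  ≡⟨ colour-b ⟩
      suc zero                                      ∎)
      where
      open ≡-Reasoning
      pair : Carrier → List (ℕ × Carrier)
      pair g = (0 , ε) ∷ (1 , g) ∷ []
      mono-pair : ∀ g → colour (applySel M regularSystem s (pair g)) ≡ col
      mono-pair g = mono (pair g) (pairSelection regularSystem ε g) (here refl)
      ε∈s₁ : Any (_≡ ε) (s 1)
      ε∈s₁ = hasDP⇒ε∈ (dp 1)
      colour-a : colour (applySel M regularSystem s (pair a)) ≡ zero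
      colour-a = colour-pair a (λ m → classify-not-above-b (∉-∙ m b∉aM))
                             (classify-above-a (∈-∙ε a)) s ε∈s₁
      colour-b : colour (applySel M regularSystem s (pair b)) ≡ suc zero
      colour-b = colour-pair b (λ m → classify-not-above-a (∉-∙ m a∉bM))
                             (classify-above-b (∉-∙ ε a∉bM) (∈-∙ε b)) s ε∈s₁

  ramsey⇒linear : Ramsey M → XLinear M
  ramsey⇒linear R a b with a ∈? b | b ∈? a
  ... | yes a∈b | _       = inj₁ (∈⇒⊆ a∈b)
  ... | no _    | yes b∈a = inj₂ (∈⇒⊆ b∈a)
  ... | no a∉b  | no b∉a  = ⊥-elim (Incomparable.not-ramsey a b a∉b b∉a R)

  maximal⇒ε∈ : ∀ y → MaximalY M y → mem y ε
  maximal⇒ε∈ y y-max = proj₁ (y-max y∪M ((λ _ → inj₁) , below) ε) (inj₂ (⊆-refl , ⊆-refl))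
    where
    y∪M : YElem M
    mem   y∪M b = mem y b ⊎ SameIdeal M b ε
    inv   y∪M a b a≈b (inj₁ ya)        = inj₁ (inv y a b a≈b ya)
    inv   y∪M a b (a⊆b , b⊆a) (inj₂ (a⊆ε , ε⊆a)) = inj₂ (⊆-trans b⊆a a⊆ε , ⊆-trans ε⊆a a⊆b)
    ne    y∪M = proj₁ (ne y) , inj₁ (proj₂ (ne y))
    chain y∪M a b (inj₁ ya) (inj₁ yb)     = chain y a b ya yb
    chain y∪M a b _         (inj₂ (_ , ε⊆b)) = inj₁ (⊆-trans (⊆-ε a) ε⊆b)
    chain y∪M a b (inj₂ (_ , ε⊆a)) (inj₁ _) = inj₂ (⊆-trans (⊆-ε b) ε⊆a)
    below : ∀ a b → mem y a → mem y∪M b → ¬ mem y b → a ⊆ b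
    below a b _ (inj₁ yb)        y∌b = ⊥-elim (y∌b yb)
    below a b _ (inj₂ (_ , ε⊆b)) _   = ⊆-trans (⊆-ε a) ε⊆b

  Bounded : Carrier → YElem M → Set
  Bounded c x = ∀ b → mem x b → b ⊆ c

  ≋-preserves-Bounded : ∀ {c w w′} → w ≋ w′ → All (Bounded c) w ⇔ All (Bounded c) w′
  ≋-preserves-Bounded (absorbˡ u v p q (p⊆q , _)) = All-splice u (p ∷ [ q ]) [ q ] v $ mk⇔
    (λ { (_ ∷ hq ∷ []) → hq ∷ [] })
    (λ { (hq ∷ []) → (λ b pb → hq b (p⊆q b pb)) ∷ hq ∷ [] })
  ≋-preserves-Bounded (absorbʳ u v p q (p⊆q , _)) = All-splice u (q ∷ [ p ]) [ q ] v $ mk⇔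
    (λ { (hq ∷ _ ∷ []) → hq ∷ [] })
    (λ { (hq ∷ []) → hq ∷ (λ b pb → hq b (p⊆q b pb)) ∷ [] })
  ≋-preserves-Bounded (ext u v p q p≃q) = All-splice u [ p ] [ q ] v $ mk⇔
    (λ { (hp ∷ []) → (λ b qb → hp b (proj₂ (p≃q b) qb)) ∷ [] })
    (λ { (hq ∷ []) → (λ b pb → hq b (proj₁ (p≃q b) pb)) ∷ [] })
  ≋-preserves-Bounded (~refl _)     = ⇔-id _
  ≋-preserves-Bounded (~sym r)      = ⇔-sym (≋-preserves-Bounded r)
  ≋-preserves-Bounded (~trans r r′) = ≋-preserves-Bounded r′ ⇔-∘ ≋-preserves-Bounded r

  HasCoefficient : Carrier → List (ℕ × Carrier) → Set
  HasCoefficient a = Any ((_≡ a) ∘ proj₂)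

  Dominated : Carrier → List (ℕ × Carrier) → Set
  Dominated a = All ((_⊆ a) ∘ proj₂)

  yWord-Bounded : ∀ y {a} sel → Dominated a sel → All (Bounded a) (yWord M y sel)
  yWord-Bounded y sel h = All.map⁺ (All.map bound h)
    where
    bound : ∀ {m a} → m ⊆ a → Bounded a (actY M m y)
    bound {m} m⊆a b (d , _ , b⊆md , _) = ⊆-trans b⊆md (⊆-trans (∙-⊆ m d) m⊆a)

  Bounded⇒⊆ : ∀ y {b c sel} → mem y ε → HasCoefficient b sel →
              All (Bounded c) (yWord M y sel) → b ⊆ c
  Bounded⇒⊆ y {b} {c} yε b∈sel h =
    All.lookupWith {R = λ _ → b ⊆ c} (λ { bounded refl → bounded b b∈b𝐲 }) (All.map⁻ h) b∈sel
    where
    b∈b𝐲 : mem (actY M b y) b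
    b∈b𝐲 = ε , yε , ≡⇒SameIdeal (sym (identityʳ b))

  dominant : XLinear M → ∀ sel → sel ≢ [] → ∃[ a ] Dominated a sel × HasCoefficient a sel
  dominant lin []                        sel≢[] = ⊥-elim (sel≢[] refl)
  dominant lin ((_ , m) ∷ [])            _      = m , ⊆-refl ∷ [] , here refl
  dominant lin ((_ , m) ∷ sel@(_ ∷ _)) _ with dominant lin sel (λ ())
  ... | a , h , a∈sel with lin m a
  ...   | inj₁ m⊆a = a , m⊆a ∷ h , there a∈sel
  ...   | inj₂ a⊆m = m , ⊆-refl ∷ All.map (λ x⊆a → ⊆-trans x⊆a a⊆m) h , here refl

  mulSel : Carrier → List (ℕ × Carrier) → List (ℕ × Carrier)
  mulSel a = map (map₂ (a ∙_))

  mulSel-indices : ∀ a sel → map proj₁ (mulSel a sel) ≡ map proj₁ sel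
  mulSel-indices a sel = sym (map-∘ sel)

  divide : ∀ {a} sel → Dominated a sel → ∃[ sel′ ] mulSel a sel′ ≡ sel
  divide []              []          = [] , refl
  divide ((i , m) ∷ sel) (m⊆a ∷ h) with ⊆⇒∈ m⊆a | divide sel h
  ... | d , refl | sel′ , refl = (i , d) ∷ sel′ , refl

  divide-ε : ∀ {a} sel → Dominated a sel → HasCoefficient a sel →
             ∃[ sel′ ] mulSel a sel′ ≡ sel × HasCoefficient ε sel′
  divide-ε ((i , _) ∷ sel) (_ ∷ h) (here refl) with divide sel h
  ... | sel′ , refl =
    (i , ε) ∷ sel′ , cong (λ m → (i , m) ∷ mulSel _ sel′) (identityʳ _) , here refl
  divide-ε ((i , m) ∷ sel) (m⊆a ∷ h) (there a∈sel) with ⊆⇒∈ m⊆a | divide-ε sel h a∈sel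
  ... | d , refl | sel′ , refl , ε∈sel′ = (i , d) ∷ sel′ , refl , there ε∈sel′

  module _ (S : MSystem M) where
    open MSystem S

    Letter : U → Set
    Letter u = ∃[ n ] X n u

    WordFrom⇒Letters : ∀ {j w} → WordFrom M S j w → All Letter w
    WordFrom⇒Letters []                        = []
    WordFrom⇒Letters (_∷_ {i = i} (_ , x) w) = (i , x) ∷ WordFrom⇒Letters w

    basic⇒Letters : ∀ {s} → Basic M S s → ∀ i → All Letter (s i)
    basic⇒Letters basic i = All.++⁻ˡ _ (WordFrom⇒Letters (proj₁ (basic [ i ] (λ ()) [-])))

    act-act : ∀ a m {w} → All Letter w → map (act a) (map (act m) w) ≡ map (act (a ∙ m)) w
    act-act a m {w} h =
      trans (sym (map-∘ w)) (map-cong-local (All.map (λ (n , x) → sym (act-∙ n a m _ x)) h))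

    act-applySel : ∀ {s} → Basic M S s → ∀ a sel →
                   map (act a) (applySel M S s sel) ≡ applySel M S s (mulSel a sel)
    act-applySel         basic a []              = refl
    act-applySel {s = s} basic a ((i , m) ∷ sel) =
      trans (map-++ (act a) (map (act m) (s i)) _)
            (cong₂ _++_ (act-act a m (basic⇒Letters basic i)) (act-applySel basic a sel))

  MonochromaticSpan : (S : MSystem M) {k : ℕ} → (List (MSystem.U S) → Fin k) →
                      (ℕ → List (MSystem.U S)) → Fin k → Set
  MonochromaticSpan S c s col =
    ∀ sel → Selection M S sel → HasCoefficient ε sel → c (applySel M S s sel) ≡ col

  translateColours : (S : MSystem M) {k : ℕ} → (List (MSystem.U S) → Fin k) →
                     List (MSystem.U S) → Fin (k ^ proj₁ finite)
  translateColours S c w = funToFin (λ i → c (map (MSystem.act S (from i)) w))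

  ramsey⇒translates-monochromatic :
    Ramsey M → ∀ S k (c : List (MSystem.U S) → Fin k) →
    ∃[ s ] (Basic M S s × (∀ n → HasDP M S (s n)) ×
            ∀ a → ∃ (MonochromaticSpan S (c ∘ map (MSystem.act S a)) s))
  ramsey⇒translates-monochromatic R S k c with R S (k ^ proj₁ finite) (translateColours S c)
  ... | s , basic , dp , col , mono = s , basic , dp , λ a → finToFun col (to a) , translate a
    where
    open MSystem S
    translate : ∀ a → MonochromaticSpan S (c ∘ map (act a)) s (finToFun col (to a))
    translate a sel sel-ok ε∈sel = begin
      c (map (act a) w)                        ≡⟨ cong (λ b → c (map (act b) w)) (strictlyInverseʳ a) ⟨
      c (map (act (from (to a))) w)            ≡⟨ finToFun-funToFin _ (to a) ⟨
      finToFun (translateColours S c w) (to a) ≡⟨ cong (λ z → finToFun z (to a)) (mono sel sel-ok ε∈sel) ⟩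
      finToFun col (to a)                      ∎
      where
      open ≡-Reasoning
      w : List U
      w = applySel M S s sel

  module Controlled (lin : XLinear M) (S : MSystem M) {k : ℕ} (c : List (MSystem.U S) → Fin k)
                    (s : ℕ → List (MSystem.U S)) (basic : Basic M S s)
                    (translates : ∀ a → ∃ (MonochromaticSpan S (c ∘ map (MSystem.act S a)) s))
                    where
    open MSystem S
    open ≡-Reasoning

    colourOf : Carrier → Fin k
    colourOf a = proj₁ (translates a)

    colour-dominated : ∀ {a} sel → Selection M S sel → Dominated a sel → HasCoefficient a sel →
                       c (applySel M S s sel) ≡ colourOf a
    colour-dominated {a} sel (_ , linked) h a∈sel with divide-ε sel h a∈sel
    ... | sel′ , refl , ε∈sel′ = begin
      c (applySel M S s (mulSel a sel′))      ≡⟨ cong c (act-applySel S basic a sel′) ⟨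
      c (map (act a) (applySel M S s sel′))   ≡⟨ proj₂ (translates a) sel′ sel′-ok ε∈sel′ ⟩
      colourOf a                              ∎
      where
      sel′-ok : Selection M S sel′
      sel′-ok = (λ { refl → Any.¬Any[] ε∈sel′ }) , subst (Linked _<_) (mulSel-indices a sel′) linked

    colourOf-SameIdeal : ∀ {a b} → a ⊆ b → b ⊆ a → colourOf a ≡ colourOf b
    colourOf-SameIdeal {a} {b} a⊆b b⊆a = begin
      colourOf a             ≡⟨ colour-dominated ab ab-ok (⊆-refl ∷ b⊆a ∷ []) (here refl) ⟨
      c (applySel M S s ab)  ≡⟨ colour-dominated ab ab-ok (a⊆b ∷ ⊆-refl ∷ []) (there (here refl)) ⟩
      colourOf b             ∎
      where
      ab : List (ℕ × Carrier)
      ab = (0 , a) ∷ (1 , b) ∷ []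
      ab-ok : Selection M S ab
      ab-ok = pairSelection S a b

    controlled : ∀ y → mem y ε → ∀ as bs → Selection M S as → Selection M S bs →
                 yWord M y as ≋ yWord M y bs → c (applySel M S s as) ≡ c (applySel M S s bs)
    controlled y yε as bs as-ok bs-ok as≋bs
      with dominant lin as (proj₁ as-ok) | dominant lin bs (proj₁ bs-ok)
    ... | a , as≤a , a∈as | b , bs≤b , b∈bs = begin
      c (applySel M S s as)   ≡⟨ colour-dominated as as-ok as≤a a∈as ⟩
      colourOf a              ≡⟨ colourOf-SameIdeal a⊆b b⊆a ⟩
      colourOf b              ≡⟨ colour-dominated bs bs-ok bs≤b b∈bs ⟨
      c (applySel M S s bs)   ∎
      where
      b⊆a : b ⊆ a
      b⊆a = Bounded⇒⊆ y yε b∈bs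
              (Equivalence.to (≋-preserves-Bounded as≋bs) (yWord-Bounded y as as≤a))
      a⊆b : a ⊆ b
      a⊆b = Bounded⇒⊆ y yε a∈as
              (Equivalence.from (≋-preserves-Bounded as≋bs) (yWord-Bounded y bs bs≤b))

  -- With 𝕏(M) linear the conclusion holds for every word.
  ramsey∧linear⇒controllable : Ramsey M → XLinear M → YControllable M
  ramsey∧linear⇒controllable R lin _ y y-max S k c with ramsey⇒translates-monochromatic R S k c
  ... | s , basic , dp , translates = s , basic , dp , λ as bs as-ok bs-ok _ →
    Controlled.controlled lin S c s basic translates y (maximal⇒ε∈ y y-max) as bs as-ok bs-ok

  ≋-cons : ∀ p {w w′} → w ≋ w′ → (p ∷ w) ≋ (p ∷ w′)
  ≋-cons p (absorbˡ u v q r q≤r) = absorbˡ (p ∷ u) v q r q≤r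
  ≋-cons p (absorbʳ u v q r q≤r) = absorbʳ (p ∷ u) v q r q≤r
  ≋-cons p (ext u v q r q≃r)     = ext (p ∷ u) v q r q≃r
  ≋-cons p (~refl w)             = ~refl (p ∷ w)
  ≋-cons p (~sym r)              = ~sym (≋-cons p r)
  ≋-cons p (~trans r r′)         = ~trans (≋-cons p r) (≋-cons p r′)

  absorb-tail : ∀ {q} v → All (λ p → _≤Y_ M p q) v → (q ∷ v) ≋ [ q ]
  absorb-tail     []      []         = ~refl _
  absorb-tail {q} (p ∷ v) (p≤q ∷ h) = ~trans (absorbʳ [] v p q p≤q) (absorb-tail v h)

  module _ (lin : XLinear M) where

    𝕏 : YElem M
    mem   𝕏 _       = ⊤
    inv   𝕏 _ _ _ _ = tt
    ne    𝕏         = ε , tt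
    chain 𝕏 a b _ _ = lin a b

    𝕏-maximal : MaximalY M 𝕏
    𝕏-maximal z (𝕏⊆z , _) a = (λ _ → tt) , (λ _ → 𝕏⊆z a tt)

    actY-≤𝕏 : ∀ a → _≤Y_ M (actY M a 𝕏) 𝕏
    actY-≤𝕏 a = (λ _ _ → tt) , below
      where
      below : ∀ b c → mem (actY M a 𝕏) b → mem 𝕏 c → ¬ mem (actY M a 𝕏) c → b ⊆ c
      below b c (d , _ , b⊆ad , _) _ c∉a𝕏 with lin b c
      ... | inj₁ b⊆c = b⊆c
      ... | inj₂ c⊆b with ⊆⇒∈ (⊆-trans c⊆b b⊆ad)
      ...   | e , refl = ⊥-elim (c∉a𝕏 (d ∙ e , tt , ≡⇒SameIdeal (assoc a d e)))

    𝕏≃ε𝕏 : _≃Y_ M 𝕏 (actY M ε 𝕏)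
    𝕏≃ε𝕏 a = (λ _ → a , tt , ≡⇒SameIdeal (sym (identityˡ a))) , (λ _ → tt)

    yWord-𝕏-collapse : ∀ sel → HasCoefficient ε sel → yWord M 𝕏 sel ≋ [ 𝕏 ]
    yWord-𝕏-collapse (_ ∷ sel) (here refl) =
      ~trans (~sym (ext [] _ 𝕏 (actY M ε 𝕏) 𝕏≃ε𝕏))
             (absorb-tail (yWord M 𝕏 sel) (All.map⁺ (All.universal (actY-≤𝕏 ∘ proj₂) sel)))
    yWord-𝕏-collapse ((_ , m) ∷ sel) (there ε∈sel) =
      ~trans (≋-cons _ (yWord-𝕏-collapse sel ε∈sel)) (absorbˡ [] [] _ 𝕏 (actY-≤𝕏 m))

  controllable∧linear⇒ramsey : YControllable M → XLinear M → Ramsey M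
  controllable∧linear⇒ramsey Y lin S k c with Y [ [ 𝕏 lin ] ] (𝕏 lin) (𝕏-maximal lin) S k c
  ... | s , basic , dp , controlled =
    s , basic , dp , c (applySel M S s first) , λ sel sel-ok ε∈sel →
      controlled sel first sel-ok first-ok (here (~sym (collapse sel ε∈sel)))
                 (~trans (collapse sel ε∈sel) (~sym (collapse first (here refl))))
    where
    first : List (ℕ × Carrier)
    first = [ 0 , ε ]
    first-ok : Selection M S first
    first-ok = (λ ()) , [-]
    collapse : ∀ sel → HasCoefficient ε sel → yWord M (𝕏 lin) sel ≋ [ 𝕏 lin ]
    collapse = yWord-𝕏-collapse lin

corollary4p8 : (M : FinMonoid) → Ramsey M ⇔ (YControllable M × XLinear M)
corollary4p8 M = mk⇔
  (λ R → ramsey∧linear⇒controllable M R (ramsey⇒linear M R) , ramsey⇒linear M R)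
  (λ (Y , lin) → controllable∧linear⇒ramsey M Y lin)
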